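{- For any $s_1,\dots,s_r\in\mathbb{N}$, the following identity holds as formal power series in $z_1,\dots,z_r$: $\mathrm{Li}^{\star}_{(s_r,\dots,s_1)}(z_r,\dots,z_1)=\sum_{\ell=2}^{r}(-1)^{\ell}\,\mathrm{Li}_{(s_1,\dots,s_{\ell-1})}(z_1,\dots,z_{\ell-1})\,\mathrm{Li}^{\star}_{(s_r,\dots,s_\ell)}(z_r,\dots,z_\ell)+(-1)^{r+1}\mathrm{Li}_{(s_1,\dots,s_r)}(z_1,\dots,z_r).$
   Context: $\theta$ is a variable over $\mathbb{F}_q$, $L_0=1$, $L_i=(\theta-\theta^q)(\theta-\theta^{q^2})\cdots(\theta-\theta^{q^i})$. For $(n_1,\dots,n_m)\in\mathbb{N}^m$: $\mathrm{Li}_{(n_1,\dots,n_m)}(z_1,\dots,z_m)=\sum_{i_1>\cdots>i_m\ge0}\frac{z_1^{q^{i_1}}\cdots z_m^{q^{i_m}}}{L_{i_1}^{n_1}\cdots L_{i_m}^{n_m}}$ and $\mathrm{Li}^{\star}_{(n_1,\dots,n_m)}(z_1,\dots,z_m)=\sum_{i_1\ge\cdots\ge i_m\ge0}\frac{z_1^{q^{i_1}}\cdots z_m^{q^{i_m}}}{L_{i_1}^{n_1}\cdots L_{i_m}^{n_m}}$. -}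

module Defs where

open import Level using (Level; _⊔_) renaming (suc to lsuc)
open import Algebra.Bundles using (CommutativeRing)
open import Data.Nat as ℕ using (ℕ; zero; suc; _^_; _∸_; _≡ᵇ_; _<ᵇ_; _≤ᵇ_)
open import Data.Bool using (Bool; true; false; _∧_; if_then_else_)
import Data.Bool
open import Data.Fin as Fin using (Fin; toℕ)
open import Data.List as List using (List; []; _∷_; map; foldr; concatMap; upTo; allFin; replicate; zip; filter)
open import Data.Bool.ListAction using (and)
open import Data.Vec as Vec using (Vec; []; _∷_; lookup; zipWith)
open import Data.Product using (_×_; _,_; proj₁; proj₂; ∃)
open import Relation.Nullary using (¬_)
open import Relation.Binary.PropositionalEquality using (_≡_)

-- The standard library
-- has no bundle for fields, so we define one: a commutative ring with
-- 1 ≠ 0 in which every nonzero element is invertible, together with an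
-- enumeration Fin q → Carrier that is bijective up to the ring's ≈.

record FiniteField (q : ℕ) (c ℓ : Level) : Set (lsuc (c ⊔ ℓ)) where
  field
    commutativeRing : CommutativeRing c ℓ
  open CommutativeRing commutativeRing public
  field
    nontrivial : ¬ (1# ≈ 0#)
    inverse    : ∀ x → ¬ (x ≈ 0#) → ∃ λ y → (x * y) ≈ 1#
    enum       : Fin q → Carrier
    enum-inj   : ∀ i j → enum i ≈ enum j → i ≡ j
    enum-surj  : ∀ x → ∃ λ i → enum i ≈ x

module OverFq {q : ℕ} {c ℓ : Level} (F : FiniteField q c ℓ) where
  private
    module F = FiniteField F
  open F using (Carrier; 0#; 1#)

  -- Polynomials in θ over F_q: coefficient lists, lowest degree first.
  Poly : Set c
  Poly = List Carrier

  coeff : Poly → ℕ → Carrier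
  coeff []      _       = 0#
  coeff (a ∷ p) zero    = a
  coeff (a ∷ p) (suc n) = coeff p n

  _≈ₚ_ : Poly → Poly → Set ℓ
  p ≈ₚ p' = ∀ n → coeff p n F.≈ coeff p' n

  _+ₚ_ : Poly → Poly → Poly
  []      +ₚ p'       = p'
  (a ∷ p) +ₚ []       = a ∷ p
  (a ∷ p) +ₚ (b ∷ p') = (a F.+ b) ∷ (p +ₚ p')

  -ₚ_ : Poly → Poly
  -ₚ p = map F.-_ p

  _*ₚ_ : Poly → Poly → Poly
  []      *ₚ p' = []
  (a ∷ p) *ₚ p' = map (a F.*_) p' +ₚ (0# ∷ (p *ₚ p'))

  _^ₚ_ : Poly → ℕ → Poly
  p ^ₚ zero  = 1# ∷ []
  p ^ₚ suc n = p *ₚ (p ^ₚ n)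

  θ^ : ℕ → Poly
  θ^ n = replicate n 0# List.++ (1# ∷ [])

  L : ℕ → Poly
  L zero    = 1# ∷ []
  L (suc i) = L i *ₚ (θ^ 1 +ₚ (-ₚ θ^ (q ^ suc i)))

  -- The rational function field F_q(θ), as fractions num / den.
  -- Equality is by cross-multiplication.  (All denominators occurring in
  -- the statement are products of the L_i, which are nonzero.)
  record K : Set c where
    constructor _/_
    field
      num : Poly
      den : Poly
  open K public

  _≈K_ : K → K → Set ℓ
  x ≈K y = (num x *ₚ den y) ≈ₚ (num y *ₚ den x)

  0K 1K : K
  0K = [] / (1# ∷ [])
  1K = (1# ∷ []) / (1# ∷ [])

  _+K_ _*K_ : K → K → K
  (a / b) +K (c' / d) = ((a *ₚ d) +ₚ (c' *ₚ b)) / (b *ₚ d)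
  (a / b) *K (c' / d) = (a *ₚ c') / (b *ₚ d)

  -K_ : K → K
  -K (a / b) = (-ₚ a) / b

  sumK : List K → K
  sumK = foldr _+K_ 0K

  -- Formal power series in r variables z_1,…,z_r (indexed by Fin r)
  -- with coefficients in F_q(θ): a series is its coefficient function on
  -- exponent vectors (e_1,…,e_r), the coefficient of z_1^{e_1}⋯z_r^{e_r}.
  FPS : ℕ → Set c
  FPS r = Vec ℕ r → K

  _≈S_ : ∀ {r} → FPS r → FPS r → Set ℓ
  f ≈S g = ∀ e → f e ≈K g e

  _+S_ : ∀ {r} → FPS r → FPS r → FPS r
  (f +S g) e = f e +K g e

  -S_ : ∀ {r} → FPS r → FPS r
  (-S f) e = -K f e

  0S : ∀ {r} → FPS r
  0S e = 0K

  below : ∀ {r} → Vec ℕ r → List (Vec ℕ r)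
  below []      = [] ∷ []
  below (x ∷ e) = concatMap (λ a → map (a ∷_) (below e)) (upTo (suc x))

  _*S_ : ∀ {r} → FPS r → FPS r → FPS r
  (f *S g) e = sumK (map (λ d → f d *K g (zipWith _∸_ e d)) (below e))

  signS : ∀ {r} → ℕ → FPS r → FPS r
  signS zero          f = f
  signS (suc zero)    f = -S f
  signS (suc (suc k)) f = signS k f

  sumS : ∀ {r} → List (FPS r) → FPS r
  sumS = foldr _+S_ 0S

  -- A depth-m polylog is specified by a list
  -- ((n_1, v_1), …, (n_m, v_m)) : the j-th weight n_j and the variable
  -- z_{v_j} in the j-th argument slot.  Thus
  --   Li_{(n_1,…,n_m)}(z_{v_1},…,z_{v_m})
  --     = Σ_{i_1 > ⋯ > i_m ≥ 0} z_{v_1}^{q^{i_1}} ⋯ z_{v_m}^{q^{i_m}}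
  --                               / (L_{i_1}^{n_1} ⋯ L_{i_m}^{n_m})
  -- and Li^⋆ likewise with i_1 ≥ ⋯ ≥ i_m ≥ 0.

  tuples : ℕ → ℕ → List (List ℕ)
  tuples zero    B = [] ∷ []
  tuples (suc m) B = concatMap (λ i → map (i ∷_) (tuples m B)) (upTo B)

  strictlyDecr weaklyDecr : List ℕ → Bool
  strictlyDecr []          = true
  strictlyDecr (x ∷ [])    = true
  strictlyDecr (x ∷ y ∷ t) = (y <ᵇ x) ∧ strictlyDecr (y ∷ t)
  weaklyDecr []          = true
  weaklyDecr (x ∷ [])    = true
  weaklyDecr (x ∷ y ∷ t) = (y ≤ᵇ x) ∧ weaklyDecr (y ∷ t)

  expOf : ∀ {r} → List (ℕ × Fin r) → List ℕ → Fin r → ℕ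
  expOf []             _       w = 0
  expOf (_ ∷ _)        []      w = 0
  expOf ((_ , v) ∷ ps) (i ∷ is) w =
    (if toℕ v ≡ᵇ toℕ w then q ^ i else 0) ℕ.+ expOf ps is w

  monoIs : ∀ {r} → List (ℕ × Fin r) → List ℕ → Vec ℕ r → Bool
  monoIs {r} ps is e = and (map (λ w → expOf ps is w ≡ᵇ lookup e w) (allFin r))

  termDen : ∀ {r} → List (ℕ × Fin r) → List ℕ → Poly
  termDen []             _        = 1# ∷ []
  termDen (_ ∷ _)        []       = 1# ∷ []
  termDen ((n , _) ∷ ps) (i ∷ is) = (L i ^ₚ n) *ₚ termDen ps is

  total : ∀ {r} → Vec ℕ r → ℕ
  total = Vec.foldr _ ℕ._+_ 0

  -- Every i with mono(i) = z^e has
  -- q^{i_j} ≤ total e, hence i_j ≤ total e, so summing over the finite box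
  -- {0,…,total e}^m collects all contributing terms.
  LiGen : ∀ {r} → (List ℕ → Bool) → List (ℕ × Fin r) → FPS r
  LiGen ord ps e =
    sumK (map (λ is → (1# ∷ []) / termDen ps is)
              (filter (λ is → Data.Bool.T? (ord is ∧ monoIs ps is e))
                      (tuples (List.length ps) (suc (total e)))))

  Li Li⋆ : ∀ {r} → List (ℕ × Fin r) → FPS r
  Li  = LiGen strictlyDecr
  Li⋆ = LiGen weaklyDecr

  pairs : ∀ {r} → Vec ℕ r → List (ℕ × Fin r)
  pairs {r} s = map (λ j → lookup s j , j) (allFin r)

module Submission where

-- Fix an exponent vector e.  Since the z_j are
-- distinct variables and i ↦ q^i is injective (q ≥ 2), at most one index
-- tuple T = (i_1,…,i_r) has monomial z_1^{q^{i_1}}⋯z_r^{q^{i_r}} = z^e.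
--   * If there is none, every series in the identity has coefficient 0 at e.
--   * If T exists, the coefficient at e of Li⋆, of Li and of each Cauchy
--     product is the fraction ⟦condition on T⟧ / (L_{i_1}^{s_1}⋯L_{i_r}^{s_r})
--     for a Boolean condition on T (in a product only the splitting of T
--     itself contributes).  The identity then reduces to the Boolean
--     telescoping identity
--       [i_r ≥ … ≥ i_1] = Σ_{k=1}^{r-1} (-1)^{k+1} [i_1 > … > i_k][i_r ≥ … ≥ i_{k+1}]
--                           + (-1)^{r+1} [i_1 > … > i_r],
--     valid in any ring.

open import Level using (Level; _⊔_)
open import Algebra.Bundles using (CommutativeMonoid; CommutativeRing; Ring)
import Algebra.Properties.Ring as RingProperties
import Algebra.Properties.CommutativeSemigroup as CommutativeSemigroupProperties
open import Data.Nat as ℕ using (ℕ; zero; suc; _^_; _∸_; _≤_; _<_; z≤n; s≤s; _≡ᵇ_; _≤ᵇ_; _<ᵇ_)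
import Data.Nat.Properties as ℕₚ
open import Data.Bool using (Bool; true; false; _∧_; not; if_then_else_; T; T?)
open import Data.Bool.Properties using (∧-commutativeMonoid)
open import Data.Fin as Fin using (Fin; toℕ)
open import Data.Fin.Properties using (toℕ-injective)
open import Data.List as List using (List; []; _∷_; map; foldr; filter; concatMap; length; upTo; take; drop; reverse; _++_; [_]; allFin)
import Data.List.Properties as Listₚ
open import Data.List.Membership.Propositional using (_∈_; find; lose)
open import Data.List.Membership.Propositional.Properties using (∈-concatMap⁺; ∈-concatMap⁻; ∈-map⁺; ∈-map⁻; ∈-upTo⁺; ∈-upTo⁻; ∈-filter⁺; ∈-filter⁻; ∈-allFin)
open import Data.List.Relation.Unary.Any using (here; there; any?)
open import Data.List.Relation.Unary.All as All using (All; []; _∷_)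
import Data.List.Relation.Unary.All.Properties as Allₚ
open import Data.List.Relation.Unary.AllPairs as AllPairs using ([]; _∷_)
import Data.List.Relation.Unary.AllPairs.Properties as AllPairsₚ
open import Data.List.Relation.Unary.Unique.Propositional using (Unique)
import Data.List.Relation.Unary.Unique.Propositional.Properties as Uniqueₚ
open import Data.Vec as Vec using (Vec; lookup; zipWith; tabulate)
open import Data.Vec.Properties using (∷-injective; lookup-zipWith; lookup∘tabulate; tabulate∘lookup; tabulate-cong)
open import Data.Product using (∃; ∃₂; _×_; _,_; proj₁; proj₂)
open import Data.Sum using (_⊎_; inj₁; inj₂)
open import Data.Empty using (⊥; ⊥-elim)
open import Function using (_∘_; id)
open import Relation.Nullary using (¬_; yes; no)
open import Relation.Binary.Definitions using (tri<; tri≈; tri>)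
import Relation.Binary.Reasoning.Setoid as SetoidReasoning
open import Relation.Binary.PropositionalEquality using (_≡_; _≢_; refl; sym; trans; cong; cong₂; subst; module ≡-Reasoning)
open import Defs

-- weaklyDecr (reverse T) checks T_1 ≤ T_2 ≤ … ≤ T_n; peeling off its first
-- comparison drives the telescoping below.  (The predicates of Defs live in
-- OverFq F but do not depend on the field F.)
module ReversedOrder {q : ℕ} {c ℓ : Level} (F : FiniteField q c ℓ) where
  open OverFq F using (weaklyDecr)

  weaklyDecr-reverse-∷ : ∀ a b U →
    weaklyDecr (reverse (a ∷ b ∷ U)) ≡ (not (b <ᵇ a) ∧ weaklyDecr (reverse (b ∷ U)))
  weaklyDecr-reverse-∷ a b U = begin
      weaklyDecr (reverse (a ∷ b ∷ U))
        ≡⟨ cong weaklyDecr (trans (Listₚ.unfold-reverse a (b ∷ U)) (cong (_++ [ a ]) (Listₚ.unfold-reverse b U))) ⟩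
      weaklyDecr ((reverse U ++ [ b ]) ++ [ a ])   ≡⟨ snoc (reverse U) b a ⟩
      (a ≤ᵇ b) ∧ weaklyDecr (reverse U ++ [ b ])
        ≡⟨ cong₂ _∧_ (≤ᵇ-not a b) (cong weaklyDecr (sym (Listₚ.unfold-reverse b U))) ⟩
      not (b <ᵇ a) ∧ weaklyDecr (reverse (b ∷ U)) ∎
    where
    open ≡-Reasoning
    open CommutativeSemigroupProperties (CommutativeMonoid.commutativeSemigroup ∧-commutativeMonoid)
      using () renaming (x∙yz≈y∙xz to ∧-lcomm)
    ≤ᵇ-not : ∀ a b → (a ≤ᵇ b) ≡ not (b <ᵇ a)
    ≤ᵇ-not zero    b       = refl
    ≤ᵇ-not (suc a) zero    = refl
    ≤ᵇ-not (suc a) (suc b) = trans (lemma a b) (≤ᵇ-not a b)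
      where lemma : ∀ a b → (a <ᵇ suc b) ≡ (a ≤ᵇ b)
            lemma zero    b = refl
            lemma (suc a) b = refl
    snoc : ∀ ys b a → weaklyDecr ((ys ++ [ b ]) ++ [ a ]) ≡ ((a ≤ᵇ b) ∧ weaklyDecr (ys ++ [ b ]))
    snoc []            b a = refl
    snoc (y ∷ [])      b a = ∧-lcomm (b ≤ᵇ y) (a ≤ᵇ b) true
    snoc (y ∷ y′ ∷ ys) b a = trans (cong ((y′ ≤ᵇ y) ∧_) (snoc (y′ ∷ ys) b a)) (∧-lcomm (y′ ≤ᵇ y) (a ≤ᵇ b) _)

-- The Boolean telescoping identity, in an arbitrary ring R (the finite field
-- F only serves to name the order predicates of Defs).
module Telescoping {q : ℕ} {c ℓ c′ ℓ′ : Level} (F : FiniteField q c ℓ) (R : Ring c′ ℓ′) where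
  open OverFq F using (strictlyDecr; weaklyDecr)
  open ReversedOrder F using (weaklyDecr-reverse-∷)
  open Ring R renaming (refl to ≈-refl; sym to ≈-sym; trans to ≈-trans)
  open RingProperties R using (-‿distribʳ-*; -‿involutive; -‿+-comm; -0#≈0#)
  open SetoidReasoning setoid

  sign : ℕ → Carrier → Carrier
  sign zero          x = x
  sign (suc zero)    x = - x
  sign (suc (suc k)) x = sign k x

  sign-suc : ∀ k x → sign (suc k) x ≈ - sign k x
  sign-suc zero          x = ≈-refl
  sign-suc (suc zero)    x = ≈-sym (-‿involutive x)
  sign-suc (suc (suc k)) x = sign-suc k x

  sign-*ˡ : ∀ k b x → sign k (b * x) ≈ b * sign k x
  sign-*ˡ zero          b x = ≈-refl
  sign-*ˡ (suc zero)    b x = -‿distribʳ-* b x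
  sign-*ˡ (suc (suc k)) b x = sign-*ˡ k b x

  sign-cong : ∀ k {x y} → x ≈ y → sign k x ≈ sign k y
  sign-cong zero          x≈y = x≈y
  sign-cong (suc zero)    x≈y = -‿cong x≈y
  sign-cong (suc (suc k)) x≈y = sign-cong k x≈y

  ⟦_⟧ : Bool → Carrier
  ⟦ b ⟧ = if b then 1# else 0#

  ⟦∧⟧ : ∀ x y → ⟦ x ∧ y ⟧ ≈ ⟦ x ⟧ * ⟦ y ⟧
  ⟦∧⟧ true  y = ≈-sym (*-identityˡ _)
  ⟦∧⟧ false y = ≈-sym (zeroˡ _)

  ⟦not∧⟧ : ∀ x y → ⟦ y ⟧ - ⟦ x ⟧ * ⟦ y ⟧ ≈ ⟦ not x ∧ y ⟧
  ⟦not∧⟧ true  y = ≈-trans (+-congˡ (-‿cong (*-identityˡ _))) (-‿inverseʳ _)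
  ⟦not∧⟧ false y = ≈-trans (+-congˡ (≈-trans (-‿cong (zeroˡ _)) -0#≈0#)) (+-identityʳ _)

  sumR : List Carrier → Carrier
  sumR = foldr _+_ 0#

  splitIndicator : List ℕ → ℕ → Carrier
  splitIndicator T k = ⟦ strictlyDecr (take k T) ⟧ * ⟦ weaklyDecr (reverse (drop k T)) ⟧

  alternatingSum : ℕ → List ℕ → Carrier
  alternatingSum n T =
    sumR (map (λ k → sign (suc k) (splitIndicator T k)) (map suc (upTo (n ∸ 1))))
    + sign (suc n) ⟦ strictlyDecr T ⟧

  sum-shift : ∀ (β : Carrier) (G H : ℕ → Carrier) → (∀ j → G (suc (suc j)) ≈ - (β * H (suc j))) →
    ∀ J → sumR (map G (map suc (map suc J))) ≈ - (β * sumR (map H (map suc J)))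
  sum-shift β G H shift [] = ≈-sym (≈-trans (-‿cong (zeroʳ β)) -0#≈0#)
  sum-shift β G H shift (j ∷ J) = begin
    G (suc (suc j)) + sumR (map G (map suc (map suc J)))
      ≈⟨ +-cong (shift j) (sum-shift β G H shift J) ⟩
    - (β * H (suc j)) + - (β * sumR (map H (map suc J)))   ≈⟨ -‿+-comm _ _ ⟩
    - (β * H (suc j) + β * sumR (map H (map suc J)))       ≈⟨ -‿cong (distribˡ β _ _) ⟨
    - (β * (H (suc j) + sumR (map H (map suc J))))          ∎

  -- one telescoping step: for T = a ∷ b ∷ U, every summand but the first
  -- carries the factor [b < a] times the corresponding summand for b ∷ U
  alternatingSum-∷ : ∀ n a b U →
    alternatingSum (suc (suc n)) (a ∷ b ∷ U)
      ≈ ⟦ weaklyDecr (reverse (b ∷ U)) ⟧ - ⟦ b <ᵇ a ⟧ * alternatingSum (suc n) (b ∷ U)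
  alternatingSum-∷ n a b U = begin
    alternatingSum (suc (suc n)) (a ∷ b ∷ U)
      ≡⟨⟩
    (1# * A + sumR (map G (map suc (List.applyUpTo suc n)))) + sign (suc (suc (suc n))) ⟦ (b <ᵇ a) ∧ strictlyDecr (b ∷ U) ⟧
      ≈⟨ +-cong (+-cong (*-identityˡ A) tail) (signed-shift (suc (suc n)) (strictlyDecr (b ∷ U))) ⟩
    (A + - (β * S)) + - (β * Last)  ≈⟨ +-assoc _ _ _ ⟩
    A + (- (β * S) + - (β * Last))  ≈⟨ +-congˡ (-‿+-comm _ _) ⟩
    A + - (β * S + β * Last)        ≈⟨ +-congˡ (-‿cong (distribˡ β S Last)) ⟨
    A - β * (S + Last)              ∎
    where
    A = ⟦ weaklyDecr (reverse (b ∷ U)) ⟧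
    β = ⟦ b <ᵇ a ⟧
    G H : ℕ → Carrier
    G k = sign (suc k) (splitIndicator (a ∷ b ∷ U) k)
    H k = sign (suc k) (splitIndicator (b ∷ U) k)
    S = sumR (map H (map suc (upTo n)))
    Last = sign (suc (suc n)) ⟦ strictlyDecr (b ∷ U) ⟧
    signed-shift : ∀ k x → sign (suc k) ⟦ (b <ᵇ a) ∧ x ⟧ ≈ - (β * sign k ⟦ x ⟧)
    signed-shift k x = ≈-trans (sign-suc k _) (-‿cong (≈-trans (sign-cong k (⟦∧⟧ (b <ᵇ a) x)) (sign-*ˡ k β _)))
    shift : ∀ j → G (suc (suc j)) ≈ - (β * H (suc j))
    shift j = ≈-trans (sign-suc (suc (suc j)) _)
      (-‿cong (≈-trans (sign-cong (suc (suc j)) (≈-trans (*-congʳ (⟦∧⟧ (b <ᵇ a) _)) (*-assoc _ _ _)))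
                       (sign-*ˡ (suc (suc j)) β _)))
    tail : sumR (map G (map suc (List.applyUpTo suc n))) ≈ - (β * S)
    tail = begin
      sumR (map G (map suc (List.applyUpTo suc n)))  ≡⟨ cong (λ J → sumR (map G (map suc J))) (Listₚ.map-upTo suc n) ⟨
      sumR (map G (map suc (map suc (upTo n))))      ≈⟨ sum-shift β G H shift (upTo n) ⟩
      - (β * S)                                      ∎

  telescope : ∀ a U → alternatingSum (suc (length U)) (a ∷ U) ≈ ⟦ weaklyDecr (reverse (a ∷ U)) ⟧
  telescope a []      = +-identityˡ 1#
  telescope a (b ∷ U) = begin
    alternatingSum (suc (suc (length U))) (a ∷ b ∷ U)          ≈⟨ alternatingSum-∷ (length U) a b U ⟩
    A - ⟦ b <ᵇ a ⟧ * alternatingSum (suc (length U)) (b ∷ U)   ≈⟨ +-congˡ (-‿cong (*-congˡ (telescope b U))) ⟩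
    A - ⟦ b <ᵇ a ⟧ * A                                         ≈⟨ ⟦not∧⟧ (b <ᵇ a) _ ⟩
    ⟦ not (b <ᵇ a) ∧ weaklyDecr (reverse (b ∷ U)) ⟧            ≡⟨ cong ⟦_⟧ (weaklyDecr-reverse-∷ a b U) ⟨
    ⟦ weaklyDecr (reverse (a ∷ b ∷ U)) ⟧                       ∎
    where A = ⟦ weaklyDecr (reverse (b ∷ U)) ⟧

length-reverse-≡ : ∀ {A B : Set} (xs : List A) (ys : List B) → length xs ≡ length ys →
  length (reverse xs) ≡ length (reverse ys)
length-reverse-≡ xs ys len = trans (Listₚ.length-reverse xs) (trans len (sym (Listₚ.length-reverse ys)))

length-take-≡ : ∀ {A B : Set} k (xs : List A) (ys : List B) → length xs ≡ length ys →
  length (take k xs) ≡ length (take k ys)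
length-take-≡ k xs ys len = trans (Listₚ.length-take k xs) (trans (cong (k ℕ.⊓_) len) (sym (Listₚ.length-take k ys)))

length-drop-≡ : ∀ {A B : Set} k (xs : List A) (ys : List B) → length xs ≡ length ys →
  length (drop k xs) ≡ length (drop k ys)
length-drop-≡ k xs ys len = trans (Listₚ.length-drop k xs) (trans (cong (_∸ k) len) (sym (Listₚ.length-drop k ys)))

++-prefix-injective : ∀ {A : Set} (xs xs′ ys ys′ : List A) →
  length xs ≡ length xs′ → xs ++ ys ≡ xs′ ++ ys′ → xs ≡ xs′
++-prefix-injective []       []         ys ys′ _   _  = refl
++-prefix-injective (x ∷ xs) (x′ ∷ xs′) ys ys′ len eq =
  cong₂ _∷_ (Listₚ.∷-injectiveˡ eq)
            (++-prefix-injective xs xs′ ys ys′ (ℕₚ.suc-injective len) (Listₚ.∷-injectiveʳ eq))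

-- Both `tuples`
-- and `below` of Defs are built by iterating this construction.
module PairedEnumeration {A B : Set} (f : ℕ → A → B)
  (f-injective : ∀ {a a′ x x′} → f a x ≡ f a′ x′ → a ≡ a′ × x ≡ x′) where

  enumeration : List A → ℕ → List B
  enumeration L n = concatMap (λ a → map (f a) L) (upTo n)

  ∈-enumeration⁻ : ∀ {L n y} → y ∈ enumeration L n → ∃₂ λ a x → a < n × x ∈ L × y ≡ f a x
  ∈-enumeration⁻ {L} {n} y∈ with find (∈-concatMap⁻ (λ a → map (f a) L) {xs = upTo n} y∈)
  ... | a , a∈ , y∈map with ∈-map⁻ (f a) y∈map
  ...   | x , x∈ , y≡ = a , x , ∈-upTo⁻ a∈ , x∈ , y≡

  ∈-enumeration⁺ : ∀ {L n a x} → a < n → x ∈ L → f a x ∈ enumeration L n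
  ∈-enumeration⁺ {L} {n} a<n x∈ =
    ∈-concatMap⁺ (λ a → map (f a) L) {xs = upTo n} (lose (∈-upTo⁺ a<n) (∈-map⁺ (f _) x∈))

  enumeration-unique : ∀ {L} n → Unique L → Unique (enumeration L n)
  enumeration-unique {L} n L-unique =
    Uniqueₚ.concat⁺ (Allₚ.map⁺ (All.tabulate (λ _ → Uniqueₚ.map⁺ (proj₂ ∘ f-injective) L-unique)))
                    (AllPairsₚ.map⁺ (AllPairs.map (λ a≢a′ → λ { (y∈ , y∈′) → disjoint a≢a′ y∈ y∈′ })
                                                  (Uniqueₚ.upTo⁺ n)))
    where
    disjoint : ∀ {a a′ y} → a ≢ a′ → y ∈ map (f a) L → y ∈ map (f a′) L → ⊥
    disjoint a≢a′ y∈ y∈′ with ∈-map⁻ (f _) y∈ | ∈-map⁻ (f _) y∈′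
    ... | _ , _ , refl | _ , _ , fx≡fx′ = a≢a′ (proj₁ (f-injective fx≡fx′))

module PolynomialRing {q : ℕ} {c ℓ : Level} (F : FiniteField q c ℓ) where
  open OverFq F
  private module F = FiniteField F
  open F using (Carrier; 0#; 1#; _≈_)
  open RingProperties F.ring using (-0#≈0#)
  open CommutativeSemigroupProperties F.+-commutativeSemigroup using (interchange; x∙yz≈y∙xz)

  -- coefficientwise equality, wrapped in a record so that the compared
  -- polynomials can be inferred from it
  record _≋_ (p p′ : Poly) : Set ℓ where
    constructor coeffwise
    field coeff-≈ : p ≈ₚ p′
  open _≋_ public
  infix 4 _≋_

  ≋-refl : ∀ {p} → p ≋ p
  ≋-refl = coeffwise λ n → F.refl

  ≋-sym : ∀ {p p′} → p ≋ p′ → p′ ≋ p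
  ≋-sym (coeffwise e) = coeffwise λ n → F.sym (e n)

  ≋-trans : ∀ {p p′ p″} → p ≋ p′ → p′ ≋ p″ → p ≋ p″
  ≋-trans (coeffwise e) (coeffwise e′) = coeffwise λ n → F.trans (e n) (e′ n)

  ≡⇒≋ : ∀ {p p′} → p ≡ p′ → p ≋ p′
  ≡⇒≋ refl = ≋-refl

  _·_ : Carrier → Poly → Poly
  a · p = map (a F.*_) p

  θ* : Poly → Poly
  θ* p = 0# ∷ p

  coeff-+ : ∀ p p′ n → coeff (p +ₚ p′) n ≈ coeff p n F.+ coeff p′ n
  coeff-+ []      p′       n       = F.sym (F.+-identityˡ _)
  coeff-+ (a ∷ p) []       n       = F.sym (F.+-identityʳ _)
  coeff-+ (a ∷ p) (b ∷ p′) zero    = F.refl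
  coeff-+ (a ∷ p) (b ∷ p′) (suc n) = coeff-+ p p′ n

  coeff-· : ∀ a p n → coeff (a · p) n ≈ a F.* coeff p n
  coeff-· a []      n       = F.sym (F.zeroʳ a)
  coeff-· a (x ∷ p) zero    = F.refl
  coeff-· a (x ∷ p) (suc n) = coeff-· a p n

  coeff-neg : ∀ p n → coeff (-ₚ p) n ≈ F.- coeff p n
  coeff-neg []      n       = F.sym -0#≈0#
  coeff-neg (x ∷ p) zero    = F.refl
  coeff-neg (x ∷ p) (suc n) = coeff-neg p n

  ∷-cong : ∀ {a a′ p p′} → a ≈ a′ → p ≋ p′ → (a ∷ p) ≋ (a′ ∷ p′)
  ∷-cong a≈ (coeffwise e) = coeffwise λ { zero → a≈ ; (suc n) → e n }

  ∷-head : ∀ {a a′ p p′} → (a ∷ p) ≋ (a′ ∷ p′) → a ≈ a′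
  ∷-head (coeffwise e) = e zero

  ∷-tail : ∀ {a a′ p p′} → (a ∷ p) ≋ (a′ ∷ p′) → p ≋ p′
  ∷-tail (coeffwise e) = coeffwise λ n → e (suc n)

  ∷-tail-zero : ∀ {a p} → (a ∷ p) ≋ [] → p ≋ []
  ∷-tail-zero (coeffwise e) = coeffwise λ n → e (suc n)

  +ₚ-cong : ∀ {p p′ r r′} → p ≋ p′ → r ≋ r′ → (p +ₚ r) ≋ (p′ +ₚ r′)
  +ₚ-cong {p} {p′} {r} {r′} (coeffwise e) (coeffwise e′) = coeffwise λ n →
    F.trans (coeff-+ p r n) (F.trans (F.+-cong (e n) (e′ n)) (F.sym (coeff-+ p′ r′ n)))

  +ₚ-comm : ∀ p r → (p +ₚ r) ≋ (r +ₚ p)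
  +ₚ-comm p r = coeffwise λ n → F.trans (coeff-+ p r n) (F.trans (F.+-comm _ _) (F.sym (coeff-+ r p n)))

  +ₚ-assoc : ∀ p r s → ((p +ₚ r) +ₚ s) ≋ (p +ₚ (r +ₚ s))
  +ₚ-assoc p r s = coeffwise λ n → begin
    coeff ((p +ₚ r) +ₚ s) n                   ≈⟨ F.trans (coeff-+ (p +ₚ r) s n) (F.+-congʳ (coeff-+ p r n)) ⟩
    (coeff p n F.+ coeff r n) F.+ coeff s n   ≈⟨ F.+-assoc _ _ _ ⟩
    coeff p n F.+ (coeff r n F.+ coeff s n)   ≈⟨ F.trans (coeff-+ p (r +ₚ s) n) (F.+-congˡ (coeff-+ r s n)) ⟨
    coeff (p +ₚ (r +ₚ s)) n                   ∎
    where open SetoidReasoning F.setoid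

  +ₚ-interchange : ∀ a b x y → ((a +ₚ b) +ₚ (x +ₚ y)) ≋ ((a +ₚ x) +ₚ (b +ₚ y))
  +ₚ-interchange a b x y = coeffwise λ n →
    F.trans (F.trans (coeff-+ (a +ₚ b) _ n) (F.+-cong (coeff-+ a b n) (coeff-+ x y n)))
      (F.trans (interchange _ _ _ _)
        (F.sym (F.trans (coeff-+ (a +ₚ x) _ n) (F.+-cong (coeff-+ a x n) (coeff-+ b y n)))))

  +ₚ-lcomm : ∀ a b x → (a +ₚ (b +ₚ x)) ≋ (b +ₚ (a +ₚ x))
  +ₚ-lcomm a b x = coeffwise λ n →
    F.trans (F.trans (coeff-+ a _ n) (F.+-congˡ (coeff-+ b x n)))
      (F.trans (x∙yz≈y∙xz _ _ _) (F.sym (F.trans (coeff-+ b _ n) (F.+-congˡ (coeff-+ a x n)))))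

  +ₚ-identityʳ : ∀ p → (p +ₚ []) ≋ p
  +ₚ-identityʳ []      = ≋-refl
  +ₚ-identityʳ (x ∷ p) = ≋-refl

  -ₚ-cong : ∀ {p p′} → p ≋ p′ → (-ₚ p) ≋ (-ₚ p′)
  -ₚ-cong {p} {p′} (coeffwise e) = coeffwise λ n →
    F.trans (coeff-neg p n) (F.trans (F.-‿cong (e n)) (F.sym (coeff-neg p′ n)))

  -ₚ-inverseʳ : ∀ p → (p +ₚ (-ₚ p)) ≋ []
  -ₚ-inverseʳ p = coeffwise λ n →
    F.trans (coeff-+ p (-ₚ p) n) (F.trans (F.+-congˡ (coeff-neg p n)) (F.-‿inverseʳ _))

  -ₚ-inverseˡ : ∀ p → ((-ₚ p) +ₚ p) ≋ []
  -ₚ-inverseˡ p = ≋-trans (+ₚ-comm (-ₚ p) p) (-ₚ-inverseʳ p)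

  ·-cong : ∀ {a a′ p p′} → a ≈ a′ → p ≋ p′ → (a · p) ≋ (a′ · p′)
  ·-cong {a} {a′} {p} {p′} a≈ (coeffwise e) = coeffwise λ n →
    F.trans (coeff-· a p n) (F.trans (F.*-cong a≈ (e n)) (F.sym (coeff-· a′ p′ n)))

  ·-distribˡ : ∀ a p r → (a · (p +ₚ r)) ≋ ((a · p) +ₚ (a · r))
  ·-distribˡ a p r = coeffwise λ n →
    F.trans (F.trans (coeff-· a (p +ₚ r) n) (F.*-congˡ (coeff-+ p r n)))
      (F.trans (F.distribˡ _ _ _) (F.sym (F.trans (coeff-+ (a · p) (a · r) n) (F.+-cong (coeff-· a p n) (coeff-· a r n)))))

  ·-distribʳ : ∀ a b p → ((a F.+ b) · p) ≋ ((a · p) +ₚ (b · p))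
  ·-distribʳ a b p = coeffwise λ n →
    F.trans (coeff-· _ p n) (F.trans (F.distribʳ _ _ _)
      (F.sym (F.trans (coeff-+ (a · p) (b · p) n) (F.+-cong (coeff-· a p n) (coeff-· b p n)))))

  ·-assoc : ∀ a b p → (a · (b · p)) ≋ ((a F.* b) · p)
  ·-assoc a b p = coeffwise λ n →
    F.trans (F.trans (coeff-· a (b · p) n) (F.*-congˡ (coeff-· b p n)))
      (F.trans (F.sym (F.*-assoc _ _ _)) (F.sym (coeff-· (a F.* b) p n)))

  0·p : ∀ p → (0# · p) ≋ []
  0·p p = coeffwise λ n → F.trans (coeff-· 0# p n) (F.zeroˡ _)

  1·p : ∀ p → (1# · p) ≋ p
  1·p p = coeffwise λ n → F.trans (coeff-· 1# p n) (F.*-identityˡ _)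

  θ*-cong : ∀ {p r} → p ≋ r → θ* p ≋ θ* r
  θ*-cong = ∷-cong F.refl

  θ*-zero : ∀ {p} → p ≋ [] → θ* p ≋ []
  θ*-zero (coeffwise e) = coeffwise λ { zero → F.refl ; (suc n) → e n }

  θ*-+ : ∀ p r → θ* (p +ₚ r) ≋ (θ* p +ₚ θ* r)
  θ*-+ p r = ∷-cong (F.sym (F.+-identityˡ 0#)) ≋-refl

  θ*-*ₚ : ∀ p x → (θ* p *ₚ x) ≋ θ* (p *ₚ x)
  θ*-*ₚ p x = +ₚ-cong (0·p x) ≋-refl

  *ₚ-zeroʳ : ∀ p → (p *ₚ []) ≋ []
  *ₚ-zeroʳ []      = ≋-refl
  *ₚ-zeroʳ (a ∷ p) = θ*-zero (*ₚ-zeroʳ p)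

  *ₚ-zeroˡ : ∀ {p} x → p ≋ [] → (p *ₚ x) ≋ []
  *ₚ-zeroˡ {[]}    x p≋0 = ≋-refl
  *ₚ-zeroˡ {a ∷ p} x p≋0 =
    +ₚ-cong (≋-trans (·-cong (coeff-≈ p≋0 zero) ≋-refl) (0·p x)) (θ*-zero (*ₚ-zeroˡ x (∷-tail-zero p≋0)))

  *ₚ-congʳ : ∀ {p p′} x → p ≋ p′ → (p *ₚ x) ≋ (p′ *ₚ x)
  *ₚ-congʳ {[]}    {p′}      x e = ≋-sym (*ₚ-zeroˡ x (≋-sym e))
  *ₚ-congʳ {a ∷ p} {[]}      x e = *ₚ-zeroˡ x e
  *ₚ-congʳ {a ∷ p} {a′ ∷ p′} x e = +ₚ-cong (·-cong (∷-head e) ≋-refl) (θ*-cong (*ₚ-congʳ x (∷-tail e)))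

  ·-*ₚ : ∀ a p x → ((a · p) *ₚ x) ≋ (a · (p *ₚ x))
  ·-*ₚ a []      x = ≋-refl
  ·-*ₚ a (b ∷ p) x =
    ≋-trans (+ₚ-cong (≋-sym (·-assoc a b x)) (≋-trans (θ*-cong (·-*ₚ a p x)) (∷-cong (F.sym (F.zeroʳ a)) ≋-refl)))
            (≋-sym (·-distribˡ a (b · x) (θ* (p *ₚ x))))

  *ₚ-distribʳ : ∀ p r x → ((p +ₚ r) *ₚ x) ≋ ((p *ₚ x) +ₚ (r *ₚ x))
  *ₚ-distribʳ []      r       x = ≋-refl
  *ₚ-distribʳ (a ∷ p) []      x = ≋-sym (+ₚ-identityʳ _)
  *ₚ-distribʳ (a ∷ p) (b ∷ r) x =
    ≋-trans (+ₚ-cong (·-distribʳ a b x) (≋-trans (θ*-cong (*ₚ-distribʳ p r x)) (θ*-+ (p *ₚ x) (r *ₚ x))))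
            (+ₚ-interchange (a · x) (b · x) (θ* (p *ₚ x)) (θ* (r *ₚ x)))

  *ₚ-distribˡ : ∀ x p r → (x *ₚ (p +ₚ r)) ≋ ((x *ₚ p) +ₚ (x *ₚ r))
  *ₚ-distribˡ []      p r = ≋-refl
  *ₚ-distribˡ (a ∷ x) p r =
    ≋-trans (+ₚ-cong (·-distribˡ a p r) (≋-trans (θ*-cong (*ₚ-distribˡ x p r)) (θ*-+ (x *ₚ p) (x *ₚ r))))
            (+ₚ-interchange (a · p) (a · r) (θ* (x *ₚ p)) (θ* (x *ₚ r)))

  *ₚ-assoc : ∀ p y z → ((p *ₚ y) *ₚ z) ≋ (p *ₚ (y *ₚ z))
  *ₚ-assoc []      y z = ≋-refl
  *ₚ-assoc (a ∷ p) y z =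
    ≋-trans (*ₚ-distribʳ (a · y) (θ* (p *ₚ y)) z)
            (+ₚ-cong (·-*ₚ a y z) (≋-trans (θ*-*ₚ (p *ₚ y) z) (θ*-cong (*ₚ-assoc p y z))))

  *ₚ-∷ : ∀ p b x → (p *ₚ (b ∷ x)) ≋ ((b · p) +ₚ θ* (p *ₚ x))
  *ₚ-∷ []      b x = ≋-sym (θ*-zero ≋-refl)
  *ₚ-∷ (a ∷ p) b x =
    ∷-cong (F.+-congʳ (F.*-comm a b))
      (≋-trans (+ₚ-cong ≋-refl (*ₚ-∷ p b x)) (+ₚ-lcomm (a · x) (b · p) (θ* (p *ₚ x))))

  *ₚ-comm : ∀ p x → (p *ₚ x) ≋ (x *ₚ p)
  *ₚ-comm p []      = *ₚ-zeroʳ p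
  *ₚ-comm p (b ∷ x) = ≋-trans (*ₚ-∷ p b x) (+ₚ-cong ≋-refl (θ*-cong (*ₚ-comm p x)))

  *ₚ-congˡ : ∀ x {p p′} → p ≋ p′ → (x *ₚ p) ≋ (x *ₚ p′)
  *ₚ-congˡ x {p} {p′} e = ≋-trans (*ₚ-comm x p) (≋-trans (*ₚ-congʳ x e) (*ₚ-comm p′ x))

  *ₚ-cong : ∀ {p p′ x x′} → p ≋ p′ → x ≋ x′ → (p *ₚ x) ≋ (p′ *ₚ x′)
  *ₚ-cong {p′ = p′} {x = x} e e′ = ≋-trans (*ₚ-congʳ x e) (*ₚ-congˡ p′ e′)

  *ₚ-identityˡ : ∀ p → ((1# ∷ []) *ₚ p) ≋ p
  *ₚ-identityˡ p = ≋-trans (+ₚ-cong (1·p p) (θ*-zero ≋-refl)) (+ₚ-identityʳ p)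

  *ₚ-identityʳ : ∀ p → (p *ₚ (1# ∷ [])) ≋ p
  *ₚ-identityʳ p = ≋-trans (*ₚ-comm p _) (*ₚ-identityˡ p)

  polyRing : CommutativeRing c ℓ
  polyRing = record
    { Carrier = Poly ; _≈_ = _≋_ ; _+_ = _+ₚ_ ; _*_ = _*ₚ_ ; -_ = -ₚ_ ; 0# = [] ; 1# = 1# ∷ []
    ; isCommutativeRing = record
      { isRing = record
        { +-isAbelianGroup = record
          { isGroup = record
            { isMonoid = record
              { isSemigroup = record
                { isMagma = record
                  { isEquivalence = record { refl = ≋-refl ; sym = ≋-sym ; trans = ≋-trans }
                  ; ∙-cong = +ₚ-cong }
                ; assoc = +ₚ-assoc }
              ; identity = (λ p → ≋-refl) , +ₚ-identityʳ }
            ; inverse = -ₚ-inverseˡ , -ₚ-inverseʳ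
            ; ⁻¹-cong = -ₚ-cong }
          ; comm = +ₚ-comm }
        ; *-cong = *ₚ-cong
        ; *-assoc = *ₚ-assoc
        ; *-identity = *ₚ-identityˡ , *ₚ-identityʳ
        ; distrib = *ₚ-distribˡ , (λ x p r → *ₚ-distribʳ p r x) }
      ; *-comm = *ₚ-comm } }

-- Every coefficient we meet is either 0 or a scalar
-- over a product of L_i's; we track such values with the relation
-- x ≐ a ∕ D, "x equals the fraction a/D" for a scalar a ∈ F and D ∈ F[θ].
module Fractions {q : ℕ} {c ℓ : Level} (F : FiniteField q c ℓ) where
  open OverFq F
  open PolynomialRing F
  private
    module F = FiniteField F
    module P = CommutativeRing polyRing
  open F using (Carrier; 0#; 1#; _≈_)
  open CommutativeSemigroupProperties P.*-commutativeSemigroup using (interchange; x∙yz≈z∙yx; x∙yz≈y∙zx)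

  constant : Carrier → Poly
  constant a = a ∷ []

  record IsZero (x : K) : Set ℓ where
    constructor isZero
    field num≋0 : num x ≋ []

  data _≐_∕_ (x : K) (a : Carrier) (D : Poly) : Set (c ⊔ ℓ) where
    scaled    : (E : Poly) → num x ≋ (constant a *ₚ E) → den x ≋ (D *ₚ E) → x ≐ a ∕ D
    vanishing : a ≈ 0# → IsZero x → x ≐ a ∕ D

  IsZero-+ : ∀ {x y} → IsZero x → IsZero y → IsZero (x +K y)
  IsZero-+ {x} {y} (isZero x≋0) (isZero y≋0) = isZero (+ₚ-cong (*ₚ-zeroˡ (den y) x≋0) (*ₚ-zeroˡ (den x) y≋0))

  IsZero-*ˡ : ∀ {x y} → IsZero x → IsZero (x *K y)
  IsZero-*ˡ {x} {y} (isZero x≋0) = isZero (*ₚ-zeroˡ (num y) x≋0)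

  IsZero-*ʳ : ∀ {x y} → IsZero y → IsZero (x *K y)
  IsZero-*ʳ {x} {y} (isZero y≋0) = isZero (≋-trans (*ₚ-comm (num x) (num y)) (*ₚ-zeroˡ (num x) y≋0))

  IsZero-neg : ∀ {x} → IsZero x → IsZero (-K x)
  IsZero-neg (isZero x≋0) = isZero (-ₚ-cong {p′ = []} x≋0)

  IsZero⇒≈K : ∀ {x y} → IsZero x → IsZero y → x ≈K y
  IsZero⇒≈K {x} {y} (isZero x≋0) (isZero y≋0) =
    coeff-≈ (≋-trans (*ₚ-zeroˡ (den y) x≋0) (≋-sym (*ₚ-zeroˡ (den x) y≋0)))

  ≐-zero : ∀ {x D} → IsZero x → x ≐ 0# ∕ D
  ≐-zero = vanishing F.refl

  ≐-scalar : ∀ {x a a′ D} → a ≈ a′ → x ≐ a ∕ D → x ≐ a′ ∕ D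
  ≐-scalar a≈ (scaled E n≋ d≋)  = scaled E (≋-trans n≋ (*ₚ-congʳ E (∷-cong a≈ (≋-refl {[]})))) d≋
  ≐-scalar a≈ (vanishing a≈0 z) = vanishing (F.trans (F.sym a≈) a≈0) z

  ≐-den : ∀ {x a D D′} → D ≋ D′ → x ≐ a ∕ D → x ≐ a ∕ D′
  ≐-den D≋ (scaled E n≋ d≋)  = scaled E n≋ (≋-trans d≋ (*ₚ-congʳ E D≋))
  ≐-den D≋ (vanishing a≈0 z) = vanishing a≈0 z

  unitFraction : ∀ D → ((1# ∷ []) / D) ≐ 1# ∕ D
  unitFraction D = scaled (1# ∷ []) (≋-sym (*ₚ-identityʳ _)) (≋-sym (*ₚ-identityʳ D))

  ≐-neg : ∀ {x a D} → x ≐ a ∕ D → (-K x) ≐ F.- a ∕ D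
  ≐-neg {a = a} (scaled E n≋ d≋)  = scaled E (≋-trans (-ₚ-cong n≋) (-‿distribˡ-* (constant a) E)) d≋
    where open RingProperties P.ring using (-‿distribˡ-*)
  ≐-neg (vanishing a≈0 z) = vanishing (F.trans (F.-‿cong a≈0) (RingProperties.-0#≈0# F.ring)) (IsZero-neg z)

  ≐-+ : ∀ {x y a a′ D} → x ≐ a ∕ D → y ≐ a′ ∕ D → (x +K y) ≐ (a F.+ a′) ∕ D
  ≐-+ {x} {y} {a} {a′} {D} (scaled E n≋ d≋) (scaled E′ n≋′ d≋′) = scaled (E *ₚ (D *ₚ E′)) numerator denominator
    where
    open SetoidReasoning P.setoid
    A = constant a
    A′ = constant a′
    numerator : num (x +K y) ≋ ((A +ₚ A′) *ₚ (E *ₚ (D *ₚ E′)))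
    numerator = begin
      (num x *ₚ den y) +ₚ (num y *ₚ den x)            ≈⟨ +ₚ-cong (*ₚ-cong n≋ d≋′) (*ₚ-cong n≋′ d≋) ⟩
      ((A *ₚ E) *ₚ (D *ₚ E′)) +ₚ ((A′ *ₚ E′) *ₚ (D *ₚ E))
        ≈⟨ +ₚ-cong (P.*-assoc A E _) (P.trans (P.*-assoc A′ E′ _) (*ₚ-congˡ A′ (x∙yz≈z∙yx E′ D E))) ⟩
      (A *ₚ (E *ₚ (D *ₚ E′))) +ₚ (A′ *ₚ (E *ₚ (D *ₚ E′)))   ≈⟨ P.distribʳ _ A A′ ⟨
      (A +ₚ A′) *ₚ (E *ₚ (D *ₚ E′))                     ∎
    denominator : den (x +K y) ≋ (D *ₚ (E *ₚ (D *ₚ E′)))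
    denominator = P.trans (*ₚ-cong d≋ d≋′) (P.*-assoc D E _)
  ≐-+ {x} {y} {a} {a′} {D} (scaled E n≋ d≋) (vanishing a′≈0 (isZero y≋0)) =
    ≐-scalar (F.trans (F.sym (F.+-identityʳ a)) (F.+-congˡ (F.sym a′≈0)))
      (scaled (E *ₚ den y)
        (P.trans (+ₚ-cong (*ₚ-congʳ (den y) n≋) (*ₚ-zeroˡ (den x) y≋0))
                 (P.trans (+ₚ-identityʳ _) (P.*-assoc (constant a) E (den y))))
        (P.trans (*ₚ-congʳ (den y) d≋) (P.*-assoc D E (den y))))
  ≐-+ {x} {y} {a} {a′} {D} (vanishing a≈0 (isZero x≋0)) (scaled E′ n≋′ d≋′) =
    ≐-scalar (F.trans (F.sym (F.+-identityˡ a′)) (F.+-congʳ (F.sym a≈0)))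
      (scaled (E′ *ₚ den x)
        (P.trans (+ₚ-cong (*ₚ-zeroˡ (den y) x≋0) (*ₚ-congʳ (den x) n≋′)) (P.*-assoc (constant a′) E′ (den x)))
        (P.trans (*ₚ-congˡ (den x) d≋′) (x∙yz≈y∙zx (den x) D E′)))
  ≐-+ (vanishing a≈0 x≋0) (vanishing a′≈0 y≋0) =
    vanishing (F.trans (F.+-cong a≈0 a′≈0) (F.+-identityˡ 0#)) (IsZero-+ x≋0 y≋0)

  ≐-* : ∀ {x y a a′ D D′} → x ≐ a ∕ D → y ≐ a′ ∕ D′ → (x *K y) ≐ (a F.* a′) ∕ (D *ₚ D′)
  ≐-* {a = a} {a′} {D} {D′} (scaled E n≋ d≋) (scaled E′ n≋′ d≋′) =
    scaled (E *ₚ E′)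
      (P.trans (*ₚ-cong n≋ n≋′) (P.trans (interchange (constant a) E (constant a′) E′) (*ₚ-congʳ (E *ₚ E′) constant-*)))
      (P.trans (*ₚ-cong d≋ d≋′) (interchange D E D′ E′))
    where
    constant-* : (constant a *ₚ constant a′) ≋ constant (a F.* a′)
    constant-* = ∷-cong (F.+-identityʳ _) ≋-refl
  ≐-* {x} {y} (vanishing a≈0 x≋0) _ = vanishing (F.trans (F.*-congʳ a≈0) (F.zeroˡ _)) (IsZero-*ˡ {x} {y} x≋0)
  ≐-* {x} {y} (scaled _ _ _) (vanishing a′≈0 y≋0) =
    vanishing (F.trans (F.*-congˡ a′≈0) (F.zeroʳ _)) (IsZero-*ʳ {x} {y} y≋0)

  scaled-zero : ∀ {x a E} → a ≈ 0# → num x ≋ (constant a *ₚ E) → IsZero x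
  scaled-zero {a = a} {E} a≈0 n≋ =
    isZero (≋-trans n≋ (*ₚ-zeroˡ {constant a} E (coeffwise λ { zero → a≈0 ; (suc n) → F.refl })))

  ≐-unique : ∀ {x y a D} → x ≐ a ∕ D → y ≐ a ∕ D → x ≈K y
  ≐-unique {x} {y} {a} {D} (scaled E n≋ d≋) (scaled E′ n≋′ d≋′) = coeff-≈ (begin
    num x *ₚ den y               ≈⟨ *ₚ-cong n≋ d≋′ ⟩
    (A *ₚ E) *ₚ (D *ₚ E′)        ≈⟨ interchange A E D E′ ⟩
    (A *ₚ D) *ₚ (E *ₚ E′)        ≈⟨ *ₚ-congˡ (A *ₚ D) (*ₚ-comm E E′) ⟩
    (A *ₚ D) *ₚ (E′ *ₚ E)        ≈⟨ interchange A E′ D E ⟨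
    (A *ₚ E′) *ₚ (D *ₚ E)        ≈⟨ *ₚ-cong n≋′ d≋ ⟨
    num y *ₚ den x               ∎)
    where
    open SetoidReasoning P.setoid
    A = constant a
  ≐-unique (scaled E n≋ d≋) (vanishing a≈0 y≋0) = IsZero⇒≈K (scaled-zero a≈0 n≋) y≋0
  ≐-unique (vanishing a≈0 x≋0) (scaled E′ n≋′ d≋′) = IsZero⇒≈K x≋0 (scaled-zero a≈0 n≋′)
  ≐-unique (vanishing _ x≋0) (vanishing _ y≋0) = IsZero⇒≈K x≋0 y≋0

module IndexTuples {q : ℕ} {c ℓ : Level} (F : FiniteField q c ℓ) where
  open OverFq F
  private module F = FiniteField F

  -- a finite field has at least the two elements 0 ≠ 1
  2≤q : 2 ≤ q
  2≤q = atLeastTwo F.enum F.enum-surj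
    where
    atLeastTwo : ∀ {n} (enum : Fin n → F.Carrier) → (∀ x → ∃ λ i → enum i F.≈ x) → 2 ≤ n
    atLeastTwo {zero}        enum surj with () ← proj₁ (surj F.0#)
    atLeastTwo {suc zero}    enum surj = ⊥-elim (F.nontrivial
      (F.trans (F.sym (proj₂ (surj F.1#))) (F.trans (F.reflexive (cong enum (single _ _))) (proj₂ (surj F.0#)))))
      where single : ∀ (i j : Fin 1) → i ≡ j
            single Fin.zero Fin.zero = refl
    atLeastTwo {suc (suc n)} enum surj = s≤s (s≤s z≤n)

  q^-injective : ∀ {i j} → q ^ i ≡ q ^ j → i ≡ j
  q^-injective {i} {j} q^i≡q^j with ℕₚ.<-cmp i j
  ... | tri< i<j _ _ = ⊥-elim (ℕₚ.<-irrefl q^i≡q^j (ℕₚ.^-monoʳ-< q 2≤q i<j))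
  ... | tri≈ _ i≡j _ = i≡j
  ... | tri> _ _ j<i = ⊥-elim (ℕₚ.<-irrefl (sym q^i≡q^j) (ℕₚ.^-monoʳ-< q 2≤q j<i))

  i<q^i : ∀ i → i < q ^ i
  i<q^i zero    = s≤s z≤n
  i<q^i (suc i) = ℕₚ.≤-<-trans (i<q^i i) (ℕₚ.^-monoʳ-< q 2≤q (ℕₚ.n<1+n i))

  slot : ∀ {r} → Fin r → ℕ → Fin r → ℕ
  slot v i w = if toℕ v ≡ᵇ toℕ w then q ^ i else 0

  slot-same : ∀ {r} (v : Fin r) i → slot v i v ≡ q ^ i
  slot-same v i with toℕ v ≡ᵇ toℕ v | ℕₚ.≡⇒≡ᵇ (toℕ v) (toℕ v) refl
  ... | true | _ = refl

  slot-other : ∀ {r} (v w : Fin r) i → v ≢ w → slot v i w ≡ 0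
  slot-other v w i v≢w with toℕ v ≡ᵇ toℕ w in eq
  ... | false = refl
  ... | true  = ⊥-elim (v≢w (toℕ-injective (ℕₚ.≡ᵇ⇒≡ (toℕ v) (toℕ w) (subst T (sym eq) _))))

  expOf-++ : ∀ {r} (ps ps′ : List (ℕ × Fin r)) t t′ w → length t ≡ length ps →
    expOf (ps ++ ps′) (t ++ t′) w ≡ expOf ps t w ℕ.+ expOf ps′ t′ w
  expOf-++ []             ps′ []      t′ w _   = refl
  expOf-++ ((n , v) ∷ ps) ps′ (i ∷ t) t′ w len =
    trans (cong (slot v i w ℕ.+_) (expOf-++ ps ps′ t t′ w (ℕₚ.suc-injective len)))
          (sym (ℕₚ.+-assoc (slot v i w) (expOf ps t w) (expOf ps′ t′ w)))

  expOf-reverse : ∀ {r} (ps : List (ℕ × Fin r)) t w → length t ≡ length ps →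
    expOf (reverse ps) (reverse t) w ≡ expOf ps t w
  expOf-reverse []             []      w _   = refl
  expOf-reverse ((n , v) ∷ ps) (i ∷ t) w len = begin
    expOf (reverse ((n , v) ∷ ps)) (reverse (i ∷ t)) w
      ≡⟨ cong₂ (λ ps′ t′ → expOf ps′ t′ w) (Listₚ.unfold-reverse (n , v) ps) (Listₚ.unfold-reverse i t) ⟩
    expOf (reverse ps ++ [ (n , v) ]) (reverse t ++ [ i ]) w
      ≡⟨ expOf-++ (reverse ps) _ (reverse t) _ w (length-reverse-≡ t ps (ℕₚ.suc-injective len)) ⟩
    expOf (reverse ps) (reverse t) w ℕ.+ (slot v i w ℕ.+ 0)
      ≡⟨ cong₂ ℕ._+_ (expOf-reverse ps t w (ℕₚ.suc-injective len)) (ℕₚ.+-identityʳ _) ⟩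
    expOf ps t w ℕ.+ slot v i w
      ≡⟨ ℕₚ.+-comm (expOf ps t w) (slot v i w) ⟩
    expOf ((n , v) ∷ ps) (i ∷ t) w ∎
    where open ≡-Reasoning

  expOf-absent : ∀ {r} (ps : List (ℕ × Fin r)) t (v : Fin r) → All (v ≢_) (map proj₂ ps) → expOf ps t v ≡ 0
  expOf-absent []              t       v _            = refl
  expOf-absent ((n , v′) ∷ ps) []      v _            = refl
  expOf-absent ((n , v′) ∷ ps) (i ∷ t) v (v≢v′ ∷ v∉) =
    cong₂ ℕ._+_ (slot-other v′ v i (v≢v′ ∘ sym)) (expOf-absent ps t v v∉)

  -- with pairwise distinct variables, the exponents determine the index tuple:
  -- the exponent of the first variable is q^{i_1}, and q^_ is injective
  expOf-injective : ∀ {r} (ps : List (ℕ × Fin r)) → Unique (map proj₂ ps) → ∀ t t′ →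
    length t ≡ length ps → length t′ ≡ length ps → (∀ w → expOf ps t w ≡ expOf ps t′ w) → t ≡ t′
  expOf-injective []             _              []      []        _   _    _    = refl
  expOf-injective ((n , v) ∷ ps) (v∉ ∷ distinct) (i ∷ t) (i′ ∷ t′) len len′ same =
    cong₂ _∷_ i≡i′ (expOf-injective ps distinct t t′ (ℕₚ.suc-injective len) (ℕₚ.suc-injective len′) same-tail)
    where
    exponent-of-v : ∀ j u → expOf ((n , v) ∷ ps) (j ∷ u) v ≡ q ^ j
    exponent-of-v j u = trans (cong₂ ℕ._+_ (slot-same v j) (expOf-absent ps u v v∉)) (ℕₚ.+-identityʳ _)
    i≡i′ : i ≡ i′
    i≡i′ = q^-injective (trans (sym (exponent-of-v i t)) (trans (same v) (exponent-of-v i′ t′)))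
    same-tail : ∀ w → expOf ps t w ≡ expOf ps t′ w
    same-tail w = ℕₚ.+-cancelˡ-≡ (slot v i w) _ _ (trans (same w) (cong (λ j → slot v j w ℕ.+ expOf ps t′ w) (sym i≡i′)))

  record IndexTuple {r} (ps : List (ℕ × Fin r)) (e : Vec ℕ r) (t : List ℕ) : Set where
    constructor indexTuple
    field
      length≡  : length t ≡ length ps
      monomial : ∀ w → expOf ps t w ≡ lookup e w
  open IndexTuple public

  UniqueIndexTuples : ∀ {r} → List (ℕ × Fin r) → Set
  UniqueIndexTuples ps = ∀ {e t t′} → IndexTuple ps e t → IndexTuple ps e t′ → t ≡ t′

  distinct⇒UniqueIndexTuples : ∀ {r} (ps : List (ℕ × Fin r)) → Unique (map proj₂ ps) → UniqueIndexTuples ps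
  distinct⇒UniqueIndexTuples ps distinct (indexTuple len mono) (indexTuple len′ mono′) =
    expOf-injective ps distinct _ _ len len′ (λ w → trans (mono w) (sym (mono′ w)))

  IndexTuple-reverse : ∀ {r} {ps : List (ℕ × Fin r)} {e t} → IndexTuple ps e t → IndexTuple (reverse ps) e (reverse t)
  IndexTuple-reverse {ps = ps} {t = t} (indexTuple len mono) =
    indexTuple (length-reverse-≡ t ps len) (λ w → trans (expOf-reverse ps t w len) (mono w))

  IndexTuple-unreverse : ∀ {r} {ps : List (ℕ × Fin r)} {e t} → IndexTuple (reverse ps) e t → IndexTuple ps e (reverse t)
  IndexTuple-unreverse {ps = ps} {e} {t} tuple =
    subst (λ ps′ → IndexTuple ps′ e (reverse t)) (Listₚ.reverse-involutive ps) (IndexTuple-reverse tuple)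

  UniqueIndexTuples-reverse : ∀ {r} {ps : List (ℕ × Fin r)} → UniqueIndexTuples ps → UniqueIndexTuples (reverse ps)
  UniqueIndexTuples-reverse unique tuple tuple′ =
    Listₚ.reverse-injective (unique (IndexTuple-unreverse tuple) (IndexTuple-unreverse tuple′))

  monoIs⇒ : ∀ {r} (ps : List (ℕ × Fin r)) t e → T (monoIs ps t e) → ∀ w → expOf ps t w ≡ lookup e w
  monoIs⇒ {r} ps t e holds w =
    ℕₚ.≡ᵇ⇒≡ _ _ (All.lookup (Allₚ.all⁺ (λ w → expOf ps t w ≡ᵇ lookup e w) (allFin r) holds) (∈-allFin w))

  monoIs⇐ : ∀ {r} (ps : List (ℕ × Fin r)) t e → (∀ w → expOf ps t w ≡ lookup e w) → T (monoIs ps t e)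
  monoIs⇐ {r} ps t e mono =
    Allₚ.all⁻ (λ w → expOf ps t w ≡ᵇ lookup e w) (All.tabulate {xs = allFin r} (λ {w} _ → ℕₚ.≡⇒≡ᵇ _ _ (mono w)))

  lookup≤total : ∀ {r} (e : Vec ℕ r) w → lookup e w ≤ total e
  lookup≤total (x Vec.∷ e) Fin.zero    = ℕₚ.m≤m+n x _
  lookup≤total (x Vec.∷ e) (Fin.suc w) = ℕₚ.≤-trans (lookup≤total e w) (ℕₚ.m≤n+m _ x)

  -- every index i of a tuple with monomial z^e satisfies i < q^i ≤ total e
  IndexTuple-bounded : ∀ {r} (ps : List (ℕ × Fin r)) {e} t → IndexTuple ps e t → All (_< suc (total e)) t
  IndexTuple-bounded {r} ps {e} t (indexTuple len mono) =
    bounded ps t len (λ w → ℕₚ.≤-trans (ℕₚ.≤-reflexive (mono w)) (lookup≤total e w))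
    where
    bounded : ∀ (ps : List (ℕ × Fin r)) t → length t ≡ length ps → (∀ w → expOf ps t w ≤ total e) →
      All (_< suc (total e)) t
    bounded []             []      _   _     = []
    bounded ((n , v) ∷ ps) (i ∷ t) len bound =
      s≤s (begin
        i                                ≤⟨ ℕₚ.<⇒≤ (i<q^i i) ⟩
        q ^ i                            ≡⟨ slot-same v i ⟨
        slot v i v                       ≤⟨ ℕₚ.m≤m+n _ _ ⟩
        expOf ((n , v) ∷ ps) (i ∷ t) v   ≤⟨ bound v ⟩
        total e                          ∎)
      ∷ bounded ps t (ℕₚ.suc-injective len) (λ w → ℕₚ.≤-trans (ℕₚ.m≤n+m _ _) (bound w))
      where open ℕₚ.≤-Reasoning

  private module TupleEnumeration = PairedEnumeration (λ (a : ℕ) (x : List ℕ) → a ∷ x) Listₚ.∷-injective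

  tuples-length : ∀ m B {t} → t ∈ tuples m B → length t ≡ m
  tuples-length zero    B (here refl) = refl
  tuples-length (suc m) B t∈ with TupleEnumeration.∈-enumeration⁻ {tuples m B} {B} t∈
  ... | _ , t′ , _ , t′∈ , refl = cong suc (tuples-length m B t′∈)

  ∈-tuples : ∀ m B t → length t ≡ m → All (_< B) t → t ∈ tuples m B
  ∈-tuples zero    B []      _   _            = here refl
  ∈-tuples (suc m) B (i ∷ t) len (i<B ∷ t<B) =
    TupleEnumeration.∈-enumeration⁺ {tuples m B} {B} i<B (∈-tuples m B t (ℕₚ.suc-injective len) t<B)

  tuples-unique : ∀ m B → Unique (tuples m B)
  tuples-unique zero    B = [] ∷ []
  tuples-unique (suc m) B = TupleEnumeration.enumeration-unique B (tuples-unique m B)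

  IndexTuple⇒∈box : ∀ {r} (ps : List (ℕ × Fin r)) {e} t → IndexTuple ps e t → t ∈ tuples (length ps) (suc (total e))
  IndexTuple⇒∈box ps t tuple = ∈-tuples _ _ t (length≡ tuple) (IndexTuple-bounded ps t tuple)

  private module BelowEnumeration (r : ℕ) = PairedEnumeration (λ (a : ℕ) (x : Vec ℕ r) → a Vec.∷ x) ∷-injective

  below-≤ : ∀ {r} (e d : Vec ℕ r) → d ∈ below e → ∀ w → lookup d w ≤ lookup e w
  below-≤ (x Vec.∷ e) d d∈ w with BelowEnumeration.∈-enumeration⁻ _ {below e} {suc x} d∈
  below-≤ (x Vec.∷ e) d d∈ Fin.zero    | a , d′ , a≤x , d′∈ , refl = ℕₚ.≤-pred a≤x
  below-≤ (x Vec.∷ e) d d∈ (Fin.suc w) | a , d′ , a≤x , d′∈ , refl = below-≤ e d′ d′∈ w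

  ∈-below : ∀ {r} (e d : Vec ℕ r) → (∀ w → lookup d w ≤ lookup e w) → d ∈ below e
  ∈-below Vec.[]      Vec.[]      _   = here refl
  ∈-below (x Vec.∷ e) (a Vec.∷ d) d≤e =
    BelowEnumeration.∈-enumeration⁺ _ {below e} {suc x} (s≤s (d≤e Fin.zero)) (∈-below e d (d≤e ∘ Fin.suc))

  below-unique : ∀ {r} (e : Vec ℕ r) → Unique (below e)
  below-unique Vec.[]      = [] ∷ []
  below-unique (x Vec.∷ e) = BelowEnumeration.enumeration-unique _ (suc x) (below-unique e)

  -- whether some index tuple for ps has monomial z^e is decidable, since all
  -- candidates lie in a finite box
  IndexTuple-dec : ∀ {r} (ps : List (ℕ × Fin r)) e → ∃ (IndexTuple ps e) ⊎ (∀ t → ¬ IndexTuple ps e t)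
  IndexTuple-dec ps e with any? (λ t → T? (monoIs ps t e)) (tuples (length ps) (suc (total e)))
  ... | yes found with find found
  ...   | t , t∈ , mono = inj₁ (t , indexTuple (tuples-length _ _ t∈) (monoIs⇒ ps t e mono))
  IndexTuple-dec ps e | no none =
    inj₂ λ t tuple → none (lose (IndexTuple⇒∈box ps t tuple) (monoIs⇐ ps t e (monomial tuple)))

module PolylogCoefficient {q : ℕ} {c ℓ : Level} (F : FiniteField q c ℓ) where
  open OverFq F
  open PolynomialRing F
  open Fractions F
  open IndexTuples F
  open Telescoping F (FiniteField.ring F) using (⟦_⟧)
  private module F = FiniteField F

  sum-IsZero : ∀ {A : Set} (g : A → K) xs → (∀ {x} → x ∈ xs → IsZero (g x)) → IsZero (sumK (map g xs))
  sum-IsZero g []       _      = isZero ≋-refl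
  sum-IsZero g (x ∷ xs) zeros = IsZero-+ (zeros (here refl)) (sum-IsZero g xs (zeros ∘ there))

  sum-single : ∀ {A : Set} (g : A → K) {a D} xs x → Unique xs → x ∈ xs →
    (∀ {y} → y ∈ xs → y ≢ x → IsZero (g y)) → g x ≐ a ∕ D → sumK (map g xs) ≐ a ∕ D
  sum-single g {a} (x ∷ xs) x (x∉ ∷ unique) (here refl) others gx≐ =
    ≐-scalar (F.+-identityʳ a)
      (≐-+ gx≐ (≐-zero (sum-IsZero g xs (λ y∈ → others (there y∈) (λ { refl → All.lookup x∉ y∈ refl })))))
  sum-single g {a} (y ∷ xs) x (y∉ ∷ unique) (there x∈) others gx≐ =
    ≐-scalar (F.+-identityˡ a)
      (≐-+ (≐-zero (others (here refl) (λ { refl → All.lookup y∉ x∈ refl })))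
           (sum-single g xs x unique x∈ (others ∘ there) gx≐))

  module _ {r : ℕ} (ord : List ℕ → Bool) (ps : List (ℕ × Fin r)) (e : Vec ℕ r) where
    private
      term : List ℕ → K
      term t = (F.1# ∷ []) / termDen ps t
      test : List ℕ → Bool
      test t = ord t ∧ monoIs ps t e
      box : List (List ℕ)
      box = tuples (length ps) (suc (total e))
      summed : List (List ℕ)
      summed = filter (λ t → T? (test t)) box

      ∈summed⇒ : ∀ {t} → t ∈ summed → IndexTuple ps e t × T (ord t)
      ∈summed⇒ {t} t∈ with ∈-filter⁻ (λ t → T? (test t)) {xs = box} t∈
      ... | t∈box , passes with ord t
      ...   | true = indexTuple (tuples-length _ _ t∈box) (monoIs⇒ ps t e passes) , _

    LiGen-support : IsZero (LiGen ord ps e) ⊎ ∃ (IndexTuple ps e)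
    LiGen-support with summed | ∈summed⇒
    ... | []     | _        = inj₁ (isZero ≋-refl)
    ... | t ∷ _  | ∈summed = inj₂ (t , proj₁ (∈summed (here refl)))

    private
      summed-only : UniqueIndexTuples ps → ∀ {t t′} → IndexTuple ps e t → t′ ∈ summed → t′ ≡ t
      summed-only unique tuple t′∈ = unique (proj₁ (∈summed⇒ t′∈)) tuple

    -- the only candidate term is t itself, present exactly when ord t holds
    LiGen-coefficient : UniqueIndexTuples ps → ∀ {t} → IndexTuple ps e t →
      LiGen ord ps e ≐ ⟦ ord t ⟧ ∕ termDen ps t
    LiGen-coefficient unique {t} tuple with ord t in ord-t
    ... | false = ≐-zero (sum-IsZero term summed λ t′∈ →
                    ⊥-elim (subst T (trans (cong ord (summed-only unique tuple t′∈)) ord-t) (proj₂ (∈summed⇒ t′∈))))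
    ... | true  = sum-single term summed t (Uniqueₚ.filter⁺ (λ t → T? (test t)) (tuples-unique (length ps) (suc (total e))))
                    (∈-filter⁺ (λ t → T? (test t)) {xs = box} (IndexTuple⇒∈box ps t tuple)
                      (subst (λ b → T (b ∧ monoIs ps t e)) (sym ord-t) (monoIs⇐ ps t e (monomial tuple))))
                    (λ t′∈ t′≢t → ⊥-elim (t′≢t (summed-only unique tuple t′∈)))
                    (unitFraction (termDen ps t))

module IdentityCoefficient {q : ℕ} {c ℓ : Level} (F : FiniteField q c ℓ) where
  open OverFq F
  open PolynomialRing F
  open Fractions F
  open IndexTuples F
  open PolylogCoefficient F
  open Telescoping F (FiniteField.ring F)
  private
    module F = FiniteField F
    module P = CommutativeRing polyRing

  termDen-++ : ∀ {r} (ps ps′ : List (ℕ × Fin r)) t t′ → length t ≡ length ps →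
    termDen (ps ++ ps′) (t ++ t′) ≋ (termDen ps t *ₚ termDen ps′ t′)
  termDen-++ []             ps′ []      t′ _   = ≋-sym (*ₚ-identityˡ _)
  termDen-++ ((n , v) ∷ ps) ps′ (i ∷ t) t′ len =
    ≋-trans (*ₚ-congˡ (L i ^ₚ n) (termDen-++ ps ps′ t t′ (ℕₚ.suc-injective len))) (≋-sym (*ₚ-assoc (L i ^ₚ n) _ _))

  termDen-reverse : ∀ {r} (ps : List (ℕ × Fin r)) t → length t ≡ length ps →
    termDen (reverse ps) (reverse t) ≋ termDen ps t
  termDen-reverse []             []      _   = ≋-refl
  termDen-reverse ((n , v) ∷ ps) (i ∷ t) len = begin
    termDen (reverse ((n , v) ∷ ps)) (reverse (i ∷ t))
      ≡⟨ cong₂ termDen (Listₚ.unfold-reverse (n , v) ps) (Listₚ.unfold-reverse i t) ⟩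
    termDen (reverse ps ++ [ (n , v) ]) (reverse t ++ [ i ])
      ≈⟨ termDen-++ (reverse ps) _ (reverse t) _ (length-reverse-≡ t ps (ℕₚ.suc-injective len)) ⟩
    termDen (reverse ps) (reverse t) *ₚ ((L i ^ₚ n) *ₚ (F.1# ∷ []))
      ≈⟨ *ₚ-cong (termDen-reverse ps t (ℕₚ.suc-injective len)) (*ₚ-identityʳ (L i ^ₚ n)) ⟩
    termDen ps t *ₚ (L i ^ₚ n)   ≈⟨ *ₚ-comm (termDen ps t) (L i ^ₚ n) ⟩
    termDen ((n , v) ∷ ps) (i ∷ t) ∎
    where open SetoidReasoning P.setoid

  IsZero-signS : ∀ {r} k (f : FPS r) e → IsZero (f e) → IsZero (signS k f e)
  IsZero-signS zero          f e z = z
  IsZero-signS (suc zero)    f e z = IsZero-neg z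
  IsZero-signS (suc (suc k)) f e z = IsZero-signS k f e z

  ≐-signS : ∀ {r a D} k (f : FPS r) e → f e ≐ a ∕ D → signS k f e ≐ sign k a ∕ D
  ≐-signS zero          f e f≐ = f≐
  ≐-signS (suc zero)    f e f≐ = ≐-neg f≐
  ≐-signS (suc (suc k)) f e f≐ = ≐-signS k f e f≐

  IsZero-sumS : ∀ {r} (ks : List ℕ) (G : ℕ → FPS r) e → (∀ k → IsZero (G k e)) → IsZero (sumS (map G ks) e)
  IsZero-sumS []       G e zeros = isZero ≋-refl
  IsZero-sumS (k ∷ ks) G e zeros = IsZero-+ (zeros k) (IsZero-sumS ks G e zeros)

  ≐-sumS : ∀ {r D} (ks : List ℕ) (G : ℕ → FPS r) (a : ℕ → F.Carrier) e →
    (∀ k → G k e ≐ a k ∕ D) → sumS (map G ks) e ≐ sumR (map a ks) ∕ D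
  ≐-sumS []       G a e G≐ = ≐-zero (isZero ≋-refl)
  ≐-sumS (k ∷ ks) G a e G≐ = ≐-+ (G≐ k) (≐-sumS ks G a e G≐)

  -- The Cauchy product Li(front) · Li⋆(back), with front the first k
  -- arguments of ps and back the remaining ones reversed.  Its contributions
  -- to z^e come from pairs of index tuples, t₁ for front with monomial z^d
  -- and t₂ for back with monomial z^{e-d}; these pairs are exactly the
  -- splittings of the index tuples of ps with monomial z^e.
  module Splitting {r : ℕ} (ps : List (ℕ × Fin r)) (distinct : Unique (map proj₂ ps)) (k : ℕ) where
    front back : List (ℕ × Fin r)
    front = take k ps
    back  = reverse (drop k ps)

    joinTuples : ∀ {e d t₁ t₂} → d ∈ below e → IndexTuple front d t₁ →
      IndexTuple back (zipWith _∸_ e d) t₂ → IndexTuple ps e (t₁ ++ reverse t₂)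
    joinTuples {e} {d} {t₁} {t₂} d∈ tuple₁ tuple₂ = indexTuple length-joined monomial-joined
      where
      tuple₂′ : IndexTuple (drop k ps) (zipWith _∸_ e d) (reverse t₂)
      tuple₂′ = IndexTuple-unreverse tuple₂
      length-joined : length (t₁ ++ reverse t₂) ≡ length ps
      length-joined = trans (Listₚ.length-++ t₁)
        (trans (cong₂ ℕ._+_ (length≡ tuple₁) (length≡ tuple₂′))
               (trans (sym (Listₚ.length-++ front)) (cong length (Listₚ.take++drop≡id k ps))))
      monomial-joined : ∀ w → expOf ps (t₁ ++ reverse t₂) w ≡ lookup e w
      monomial-joined w = begin
        expOf ps (t₁ ++ reverse t₂) w
          ≡⟨ cong (λ ps′ → expOf ps′ (t₁ ++ reverse t₂) w) (Listₚ.take++drop≡id k ps) ⟨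
        expOf (front ++ drop k ps) (t₁ ++ reverse t₂) w
          ≡⟨ expOf-++ front (drop k ps) t₁ (reverse t₂) w (length≡ tuple₁) ⟩
        expOf front t₁ w ℕ.+ expOf (drop k ps) (reverse t₂) w
          ≡⟨ cong₂ ℕ._+_ (monomial tuple₁ w) (trans (monomial tuple₂′ w) (lookup-zipWith _∸_ w e d)) ⟩
        lookup d w ℕ.+ (lookup e w ∸ lookup d w)
          ≡⟨ ℕₚ.m+[n∸m]≡n (below-≤ e d d∈ w) ⟩
        lookup e w ∎
        where open ≡-Reasoning

    frontExponent : List ℕ → Vec ℕ r
    frontExponent T = tabulate (expOf front (take k T))

    module _ {e T} (tuple : IndexTuple ps e T) where
      private
        length-front : length (take k T) ≡ length front
        length-front = length-take-≡ k T ps (length≡ tuple)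
        length-back : length (drop k T) ≡ length (drop k ps)
        length-back = length-drop-≡ k T ps (length≡ tuple)
        frontExp backExp : Fin r → ℕ
        frontExp = expOf front (take k T)
        backExp  = expOf (drop k ps) (drop k T)
        exponent-split : ∀ w → lookup e w ≡ frontExp w ℕ.+ backExp w
        exponent-split w = trans (sym (monomial tuple w))
          (trans (cong₂ (λ ps′ t → expOf ps′ t w) (sym (Listₚ.take++drop≡id k ps)) (sym (Listₚ.take++drop≡id k T)))
                 (expOf-++ front (drop k ps) (take k T) (drop k T) w length-front))

      frontExponent∈below : frontExponent T ∈ below e
      frontExponent∈below = ∈-below e (frontExponent T) λ w →
        ℕₚ.≤-trans (ℕₚ.≤-reflexive (lookup∘tabulate frontExp w))
                   (ℕₚ.≤-trans (ℕₚ.m≤m+n (frontExp w) (backExp w)) (ℕₚ.≤-reflexive (sym (exponent-split w))))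

      frontTuple : IndexTuple front (frontExponent T) (take k T)
      frontTuple = indexTuple length-front (λ w → sym (lookup∘tabulate frontExp w))

      backTuple : IndexTuple back (zipWith _∸_ e (frontExponent T)) (reverse (drop k T))
      backTuple = IndexTuple-reverse {ps = drop k ps} {t = drop k T} (indexTuple length-back λ w → begin
        backExp w                                     ≡⟨ ℕₚ.m+n∸m≡n (frontExp w) (backExp w) ⟨
        (frontExp w ℕ.+ backExp w) ∸ frontExp w       ≡⟨ cong₂ _∸_ (exponent-split w) (lookup∘tabulate frontExp w) ⟨
        lookup e w ∸ lookup (frontExponent T) w       ≡⟨ lookup-zipWith _∸_ w e (frontExponent T) ⟨
        lookup (zipWith _∸_ e (frontExponent T)) w    ∎)
        where open ≡-Reasoning

      splitDen : (termDen front (take k T) *ₚ termDen back (reverse (drop k T))) ≋ termDen ps T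
      splitDen = ≋-trans (*ₚ-congˡ (termDen front (take k T)) (termDen-reverse (drop k ps) (drop k T) length-back))
        (≋-trans (≋-sym (termDen-++ front (drop k ps) (take k T) (drop k T) length-front))
                 (≡⇒≋ (cong₂ termDen (Listₚ.take++drop≡id k ps) (Listₚ.take++drop≡id k T))))

    productTerm : Vec ℕ r → Vec ℕ r → K
    productTerm e d = Li front d *K Li⋆ back (zipWith _∸_ e d)

    productTerm-support : ∀ e d → IsZero (productTerm e d)
      ⊎ ∃₂ λ t₁ t₂ → IndexTuple front d t₁ × IndexTuple back (zipWith _∸_ e d) t₂
    productTerm-support e d with LiGen-support strictlyDecr front d | LiGen-support weaklyDecr back (zipWith _∸_ e d)
    ... | inj₁ zero₁          | _                   = inj₁ (IsZero-*ˡ {Li front d} {Li⋆ back (zipWith _∸_ e d)} zero₁)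
    ... | inj₂ _              | inj₁ zero₂          = inj₁ (IsZero-*ʳ {Li front d} {Li⋆ back (zipWith _∸_ e d)} zero₂)
    ... | inj₂ (t₁ , tuple₁) | inj₂ (t₂ , tuple₂) = inj₂ (t₁ , t₂ , tuple₁ , tuple₂)

    product-vanishes : ∀ e → (∀ T → ¬ IndexTuple ps e T) → IsZero ((Li front *S Li⋆ back) e)
    product-vanishes e none = sum-IsZero (productTerm e) (below e) vanishing-term
      where
      vanishing-term : ∀ {d} → d ∈ below e → IsZero (productTerm e d)
      vanishing-term {d} d∈ with productTerm-support e d
      ... | inj₁ z                                 = z
      ... | inj₂ (t₁ , t₂ , tuple₁ , tuple₂) = ⊥-elim (none _ (joinTuples d∈ tuple₁ tuple₂))

    -- if T is the index tuple of ps for z^e, only its own splitting contributes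
    product-coefficient : ∀ {e T} → IndexTuple ps e T →
      (Li front *S Li⋆ back) e ≐ splitIndicator T k ∕ termDen ps T
    product-coefficient {e} {T} tuple =
      sum-single (productTerm e) (below e) (frontExponent T) (below-unique e) (frontExponent∈below tuple)
        other-terms
        (≐-den (splitDen tuple)
          (≐-* (LiGen-coefficient strictlyDecr front (frontExponent T) unique-front (frontTuple tuple))
               (LiGen-coefficient weaklyDecr back _ unique-back (backTuple tuple))))
      where
      unique-front : UniqueIndexTuples front
      unique-front = distinct⇒UniqueIndexTuples front (subst Unique (Listₚ.take-map k ps) (Uniqueₚ.take⁺ k distinct))
      unique-back : UniqueIndexTuples back
      unique-back = UniqueIndexTuples-reverse
        (distinct⇒UniqueIndexTuples (drop k ps) (subst Unique (Listₚ.drop-map k ps) (Uniqueₚ.drop⁺ k distinct)))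
      other-terms : ∀ {d} → d ∈ below e → d ≢ frontExponent T → IsZero (productTerm e d)
      other-terms {d} d∈ d≢ with productTerm-support e d
      ... | inj₁ z = z
      ... | inj₂ (t₁ , t₂ , tuple₁ , tuple₂) = ⊥-elim (d≢ d≡)
        where
        joined≡T : t₁ ++ reverse t₂ ≡ T
        joined≡T = distinct⇒UniqueIndexTuples ps distinct (joinTuples d∈ tuple₁ tuple₂) tuple
        t₁≡ : t₁ ≡ take k T
        t₁≡ = ++-prefix-injective t₁ (take k T) (reverse t₂) (drop k T)
                (trans (length≡ tuple₁) (sym (length≡ (frontTuple tuple))))
                (trans joined≡T (sym (Listₚ.take++drop≡id k T)))
        d≡ : d ≡ frontExponent T
        d≡ = trans (sym (tabulate∘lookup d))
                   (tabulate-cong λ w → trans (sym (monomial tuple₁ w)) (cong (λ t → expOf front t w) t₁≡))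

  module _ {r : ℕ} (s : Vec ℕ r) where
    pairs-distinct : Unique (map proj₂ (pairs s))
    pairs-distinct =
      subst Unique (sym (trans (sym (Listₚ.map-∘ (allFin r))) (Listₚ.map-id (allFin r)))) (Uniqueₚ.allFin⁺ r)

    length-pairs : length (pairs s) ≡ r
    length-pairs = trans (Listₚ.length-map _ (allFin r)) (Listₚ.length-tabulate id)

    unique-pairs : UniqueIndexTuples (pairs s)
    unique-pairs = distinct⇒UniqueIndexTuples (pairs s) pairs-distinct

    signedProduct : ℕ → FPS r
    signedProduct k = signS (suc k) (Li (take k (pairs s)) *S Li⋆ (reverse (drop k (pairs s))))

    splitRange : List ℕ
    splitRange = map suc (upTo (r ∸ 1))

    alternatingSeries : FPS r
    alternatingSeries = sumS (map signedProduct splitRange) +S signS (suc r) (Li (pairs s))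

    lhs-vanishes : ∀ e → (∀ T → ¬ IndexTuple (pairs s) e T) → IsZero (Li⋆ (reverse (pairs s)) e)
    lhs-vanishes e none with LiGen-support weaklyDecr (reverse (pairs s)) e
    ... | inj₁ z           = z
    ... | inj₂ (t , tuple) = ⊥-elim (none _ (IndexTuple-unreverse tuple))

    rhs-vanishes : ∀ e → (∀ T → ¬ IndexTuple (pairs s) e T) → IsZero (alternatingSeries e)
    rhs-vanishes e none =
      IsZero-+ (IsZero-sumS splitRange signedProduct e λ k →
                  IsZero-signS (suc k) _ e (Splitting.product-vanishes (pairs s) pairs-distinct k e none))
               (IsZero-signS (suc r) (Li (pairs s)) e Li-vanishes)
      where
      Li-vanishes : IsZero (Li (pairs s) e)
      Li-vanishes with LiGen-support strictlyDecr (pairs s) e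
      ... | inj₁ z           = z
      ... | inj₂ (t , tuple) = ⊥-elim (none t tuple)

    lhs-coefficient : ∀ {e T} → IndexTuple (pairs s) e T →
      Li⋆ (reverse (pairs s)) e ≐ ⟦ weaklyDecr (reverse T) ⟧ ∕ termDen (pairs s) T
    lhs-coefficient {e} {T} tuple =
      ≐-den (termDen-reverse (pairs s) T (length≡ tuple))
        (LiGen-coefficient weaklyDecr (reverse (pairs s)) e (UniqueIndexTuples-reverse unique-pairs) (IndexTuple-reverse tuple))

    rhs-coefficient : ∀ {e T} → IndexTuple (pairs s) e T →
      alternatingSeries e ≐ alternatingSum r T ∕ termDen (pairs s) T
    rhs-coefficient {e} {T} tuple =
      ≐-+ (≐-sumS splitRange signedProduct (λ k → sign (suc k) (splitIndicator T k)) e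
             λ k → ≐-signS (suc k) _ e (Splitting.product-coefficient (pairs s) pairs-distinct k tuple))
          (≐-signS (suc r) (Li (pairs s)) e (LiGen-coefficient strictlyDecr (pairs s) e unique-pairs tuple))

    telescope-tuple : ∀ {e T} → 1 ≤ r → IndexTuple (pairs s) e T → alternatingSum r T F.≈ ⟦ weaklyDecr (reverse T) ⟧
    telescope-tuple {T = []}    1≤r tuple with () ← subst (1 ≤_) (sym (trans (length≡ tuple) length-pairs)) 1≤r
    telescope-tuple {T = a ∷ U} _   tuple =
      subst (λ n → alternatingSum n (a ∷ U) F.≈ ⟦ weaklyDecr (reverse (a ∷ U)) ⟧)
            (trans (length≡ tuple) length-pairs) (telescope a U)

    -- Either no index tuple has
    -- monomial z^e and both sides vanish, or both sides equal scalars over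
    -- the same denominator, which agree by the telescoping identity.
    coefficient-identity : 1 ≤ r → ∀ e → Li⋆ (reverse (pairs s)) e ≈K alternatingSeries e
    coefficient-identity 1≤r e with IndexTuple-dec (pairs s) e
    ... | inj₂ none        = IsZero⇒≈K (lhs-vanishes e none) (rhs-vanishes e none)
    ... | inj₁ (T , tuple) =
      ≐-unique (lhs-coefficient tuple) (≐-scalar (telescope-tuple 1≤r tuple) (rhs-coefficient tuple))

mainTheorem5 : ∀ {c ℓ : Level} (q : ℕ) (F : FiniteField q c ℓ)
    (r : ℕ) → 1 ≤ r → (s : Vec ℕ r) →
    let open OverFq F in
    Li⋆ (reverse (pairs s))
      ≈S (sumS (map (λ k → signS (suc k)
                              (Li (take k (pairs s)) *S Li⋆ (reverse (drop k (pairs s)))))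
                    (map suc (upTo (r ∸ 1))))
          +S signS (suc r) (Li (pairs s)))
mainTheorem5 q F r 1≤r s = IdentityCoefficient.coefficient-identity F s 1≤r
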